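{- Let $G$ be a graph of order $n$ and $v\in V(G)$. Then $\operatorname{CS}(G,x)=\operatorname{CS}(G-v,x)+x\left(\operatorname{CS}(G/v,x)-\operatorname{CS}(G-N[v],x)+1 \right)$.
   Context: All graphs are finite, simple and undirected. $G-v$ is obtained by deleting $v$ and its incident edges; $N[v]$ is the closed neighbourhood of $v$, and $G-N[v]$ is obtained by deleting all vertices of $N[v]$; $G/v$ is obtained from $G-v$ by adding all missing edges between pairs of vertices of $N[v]\setminus\{v\}$. A connected set of a graph is a vertex subset inducing a connected subgraph; $S_k(G)$ is the number of connected sets of size $k$ and $\operatorname{CS}(G,x)=\sum_{k\ge 1}S_k(G)x^k$ (so the graph with no vertices has $\operatorname{CS}=0$). -}

module Defs where

open import Data.Bool using (Bool; true; false; _∧_; _∨_; not)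
open import Data.Nat using (ℕ; zero; suc)
open import Data.Integer as ℤ using (ℤ; +_; 0ℤ; 1ℤ)
open import Data.Fin using (Fin; _≟_)
open import Data.Fin.Properties using (any?; all?)
open import Data.Fin.Subset using (Subset; Side; inside; outside; _∈_; _⊆_; ∣_∣; ⊤; ⁅_⁆; ∁; _∩_; _∪_; _─_)
open import Data.Fin.Subset.Properties using (_∈?_; _⊆?_)
open import Data.Vec using (Vec; []; _∷_; tabulate)
open import Data.List using (List; []; _∷_; [_]; map; _++_; length; filter)
open import Data.Product using (Σ; ∃; _×_; _,_)
open import Data.Sum using (_⊎_)
open import Data.Empty using (⊥)
open import Relation.Nullary using (Dec; yes; no; ¬_)
open import Relation.Nullary.Decidable using (⌊_⌋; _×-dec_; _⊎-dec_; _→-dec_)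
open import Relation.Binary.PropositionalEquality using (_≡_)
import Data.Nat.Properties as ℕP

record Graph (n : ℕ) : Set where
  constructor graph
  field
    adj : Fin n → Fin n → Bool

open Graph public

Edge : ∀ {n} → Graph n → Fin n → Fin n → Set
Edge G x y = adj G x y ≡ true

record IsSimple {n : ℕ} (G : Graph n) : Set where
  field
    irrefl : ∀ x → adj G x x ≡ false
    sym    : ∀ x y → adj G x y ≡ adj G y x

-- Induced subgraphs: a graph on Fin n together with the vertex set
-- V ⊆ Fin n of the (sub)graph under consideration; adjacency is that
-- of the ambient graph restricted to V.  This is how G - v, G - N[v]
-- and G / v (whose vertex sets are subsets of V(G)) are represented.

record SubGraph (n : ℕ) : Set where
  constructor _on_
  field
    base  : Graph n
    verts : Subset n

open SubGraph public

whole : ∀ {n} → Graph n → SubGraph n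
whole G = G on ⊤

closedNbhd : ∀ {n} → Graph n → Fin n → Subset n
closedNbhd G v = tabulate (λ u → ⌊ u ≟ v ⌋ ∨ adj G v u)

deleteV : ∀ {n} → Graph n → Fin n → SubGraph n
deleteV G v = G on (⊤ ─ ⁅ v ⁆)

deleteN : ∀ {n} → Graph n → Fin n → SubGraph n
deleteN G v = G on (⊤ ─ closedNbhd G v)

-- G / v : from G - v add all missing edges between distinct
-- neighbours of v
contractAdj : ∀ {n} → Graph n → Fin n → Graph n
contractAdj G v =
  graph (λ x y → adj G x y ∨ (not ⌊ x ≟ y ⌋ ∧ (adj G v x ∧ adj G v y)))

contract : ∀ {n} → Graph n → Fin n → SubGraph n
contract G v = contractAdj G v on (⊤ ─ ⁅ v ⁆)

-- Connected sets.
-- ReachIn G T m x y : there is a walk from x to y with at most m edges,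
-- all of whose vertices lie in T (x is assumed in T by the caller).

ReachIn : ∀ {n} → Graph n → Subset n → ℕ → Fin n → Fin n → Set
ReachIn G T zero    x y = x ≡ y
ReachIn G T (suc m) x y =
  ReachIn G T m x y ⊎ ∃ (λ z → z ∈ T × ReachIn G T m x z × Edge G z y)

reachIn? : ∀ {n} (G : Graph n) T m x y → Dec (ReachIn G T m x y)
reachIn? G T zero    x y = x ≟ y
reachIn? G T (suc m) x y =
  reachIn? G T m x y ⊎-dec
  any? (λ z → (z ∈? T) ×-dec (reachIn? G T m x z ×-dec Data.Bool._≟_ (adj G z y) true))
  where import Data.Bool

-- T induces a connected subgraph of G: any two vertices of T are
-- joined by a walk inside T (on n vertices, walks of length ≤ n suffice
-- to capture connectivity).
InducesConnected : ∀ {n} → Graph n → Subset n → Set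
InducesConnected {n} G T = ∀ x → x ∈ T → ∀ y → y ∈ T → ReachIn G T n x y

inducesConnected? : ∀ {n} (G : Graph n) T → Dec (InducesConnected G T)
inducesConnected? {n} G T =
  all? (λ x → (x ∈? T) →-dec all? (λ y → (y ∈? T) →-dec reachIn? G T n x y))

IsConnectedSetOfSize : ∀ {n} → SubGraph n → ℕ → Subset n → Set
IsConnectedSetOfSize H k T =
  T ⊆ verts H × ∣ T ∣ ≡ k × InducesConnected (base H) T

isConnectedSetOfSize? : ∀ {n} (H : SubGraph n) k T → Dec (IsConnectedSetOfSize H k T)
isConnectedSetOfSize? H k T =
  (T ⊆? verts H) ×-dec (∣ T ∣ ℕP.≟ k) ×-dec inducesConnected? (base H) T

allSubsets : (n : ℕ) → List (Subset n)
allSubsets zero    = [ [] ]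
allSubsets (suc n) = map (inside ∷_) (allSubsets n) ++ map (outside ∷_) (allSubsets n)

S : ∀ {n} → SubGraph n → ℕ → ℕ
S {n} H k = length (filter (isConnectedSetOfSize? H k) (allSubsets n))

-- Polynomials with integer coefficients, as coefficient sequences
-- (p k = coefficient of x^k); equality is coefficientwise.

Poly : Set
Poly = ℕ → ℤ

_+ₚ_ : Poly → Poly → Poly
(p +ₚ q) k = p k ℤ.+ q k

_-ₚ_ : Poly → Poly → Poly
(p -ₚ q) k = p k ℤ.- q k

oneₚ : Poly
oneₚ zero    = 1ℤ
oneₚ (suc k) = 0ℤ

X*_ : Poly → Poly
(X* p) zero    = 0ℤ
(X* p) (suc k) = p k

infixl 6 _+ₚ_ _-ₚ_
infix 7 X*_

CS : ∀ {n} → SubGraph n → Poly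
CS H zero    = 0ℤ
CS H (suc k) = + S H (suc k)

-- Split the connected sets of G according to whether they contain v.  Those avoiding v
-- are exactly the connected sets of G - v.  For v ∉ T with T nonempty, T ∪ {v} is
-- connected in G iff T is connected in G / v and meets N(v): a walk through v becomes a
-- walk through the clique G / v adds on N(v), and conversely.  The connected sets of G / v
-- avoiding N(v) are exactly those of G - N[v].  Hence, for k ≥ 1,
-- S_{k+1}(G) = S_{k+1}(G - v) + S_k(G / v) - S_k(G - N[v]), while {v} is the only
-- connected set of size 1 containing v.

module Submission where

open import Defs
open import Level using (Level)
open import Function using (_∘_)
open import Data.Bool using (true; false; _∧_; _∨_; not)
open import Data.Bool.Properties using (∨-identityʳ; ∨-zeroʳ)
import Data.Bool.Properties as Bool
open import Data.Nat using (ℕ; zero; suc; _+_; _∸_; _≤_; _<_; z≤n; s≤s)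
import Data.Nat.Properties as ℕP
open import Data.Integer using (+_; 0ℤ; _⊖_) renaming (_+_ to _+ℤ_; _-_ to _-ℤ_)
import Data.Integer.Properties as ℤP
open import Data.Fin using (Fin; zero; suc; _≟_)
open import Data.Fin.Properties using (any?)
open import Data.Fin.Subset
  using (Subset; inside; outside; _∈_; _∉_; _⊆_; ∣_∣; ⊤; ⊥; ⁅_⁆; _∪_; _─_; Nonempty)
open import Data.Fin.Subset.Properties
  using (_∈?_; _⊂?_; drop-there; ∪-identityʳ; ∈⊤; x∈⁅x⁆; x∈⁅y⁆⇒x≡y; x≢y⇒x∉⁅y⁆;
         x∈p∧x∉q⇒x∈p─q; x∈p∪q⁻; p⊆p∪q; q⊆p∪q; ∣p∣≤n; p⊂q⇒∣p∣<∣q∣)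
open import Data.Vec using (_∷_; here; there; tabulate)
open import Data.Vec.Properties using (lookup∘tabulate; []=⇒lookup; lookup⇒[]=)
open import Data.List using (List; []; _∷_; _++_; map; length; filter)
open import Data.List.Properties using (filter-++; length-++; filter-≐; filter-none)
import Data.List.Relation.Unary.All as All
open import Data.Product using (∃-syntax; _×_; _,_; proj₂)
import Data.Product as Product
open import Data.Sum using (_⊎_; inj₁; inj₂)
import Data.Sum as Sum
open import Relation.Nullary using (yes; no; does; proof; ¬_; contradiction)
open import Relation.Nullary.Reflects using (Reflects; invert)
open import Relation.Nullary.Decidable using (⌊_⌋; dec-true; _×-dec_)
open import Relation.Unary using (Pred; Decidable; _≐_)
open import Relation.Unary.Properties using (_∩?_; ∁?)
open import Relation.Binary.PropositionalEquality
  using (_≡_; _≢_; refl; sym; trans; cong; cong₂; subst)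
open Relation.Binary.PropositionalEquality.≡-Reasoning

private
  variable
    a ℓ ℓ′ : Level
    A B : Set a
    n : ℕ

module _ {P : Pred A ℓ} (P? : Decidable P) where

  length-filter-map : (f : B → A) (xs : List B) →
    length (filter P? (map f xs)) ≡ length (filter (P? ∘ f) xs)
  length-filter-map f []       = refl
  length-filter-map f (x ∷ xs) with does (P? (f x))
  ... | true  = cong suc (length-filter-map f xs)
  ... | false = length-filter-map f xs

  length-filter-partition : {Q : Pred A ℓ′} (Q? : Decidable Q) (xs : List A) →
    length (filter P? xs) ≡
    length (filter (Q? ∩? P?) xs) + length (filter (∁? Q? ∩? P?) xs)
  length-filter-partition Q? []       = refl
  length-filter-partition Q? (x ∷ xs) with does (Q? x) | does (P? x)
  ... | true  | true  = cong suc (length-filter-partition Q? xs)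
  ... | false | true  = trans (cong suc (length-filter-partition Q? xs)) (sym (ℕP.+-suc _ _))
  ... | true  | false = length-filter-partition Q? xs
  ... | false | false = length-filter-partition Q? xs

count : {P : Pred (Subset n) ℓ} → Decidable P → ℕ
count {n} P? = length (filter P? (allSubsets n))

module _ {P : Pred (Subset n) ℓ} (P? : Decidable P) where

  count-cong : {Q : Pred (Subset n) ℓ′} (Q? : Decidable Q) → P ≐ Q → count P? ≡ count Q?
  count-cong Q? P≐Q = cong length (filter-≐ P? Q? P≐Q (allSubsets n))

  count-none : (∀ T → ¬ P T) → count P? ≡ 0
  count-none ¬P = cong length (filter-none P? {allSubsets n} (All.tabulate (λ {T} _ → ¬P T)))

  count-partition : {Q : Pred (Subset n) ℓ′} (Q? : Decidable Q) →
    count P? ≡ count (Q? ∩? P?) + count (∁? Q? ∩? P?)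
  count-partition Q? = length-filter-partition P? Q? (allSubsets n)

count-suc : {P : Pred (Subset (suc n)) ℓ} (P? : Decidable P) →
  count P? ≡ count (P? ∘ (inside ∷_)) + count (P? ∘ (outside ∷_))
count-suc {n} P? = begin
  length (filter P? (map (inside ∷_) Ts ++ map (outside ∷_) Ts))
    ≡⟨ cong length (filter-++ P? (map (inside ∷_) Ts) (map (outside ∷_) Ts)) ⟩
  length (filter P? (map (inside ∷_) Ts) ++ filter P? (map (outside ∷_) Ts))
    ≡⟨ length-++ (filter P? (map (inside ∷_) Ts)) ⟩
  length (filter P? (map (inside ∷_) Ts)) + length (filter P? (map (outside ∷_) Ts))
    ≡⟨ cong₂ _+_ (length-filter-map P? (inside ∷_) Ts) (length-filter-map P? (outside ∷_) Ts) ⟩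
  count (P? ∘ (inside ∷_)) + count (P? ∘ (outside ∷_)) ∎
  where
  Ts = allSubsets n

count-insert : (v : Fin n) {P : Pred (Subset n) ℓ} (P? : Decidable P) →
  count ((v ∈?_) ∩? P?) ≡ count (∁? (v ∈?_) ∩? (P? ∘ (_∪ ⁅ v ⁆)))
count-insert {suc n} zero {P} P? = begin
  count with-v
    ≡⟨ count-suc with-v ⟩
  count (with-v ∘ (inside ∷_)) + count (with-v ∘ (outside ∷_))
    ≡⟨ cong₂ _+_ (count-cong (with-v ∘ (inside ∷_)) (P? ∘ (inside ∷_)) (proj₂ , (here ,_)))
                 (count-none (with-v ∘ (outside ∷_)) λ _ ()) ⟩
  count (P? ∘ (inside ∷_)) + 0
    ≡⟨ ℕP.+-comm _ 0 ⟩
  0 + count (P? ∘ (inside ∷_))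
    ≡⟨ sym (cong₂ _+_ (count-none (without-v ∘ (inside ∷_)) λ _ (∉ , _) → ∉ here)
                      (count-cong (without-v ∘ (outside ∷_)) (P? ∘ (inside ∷_)) ∪⁅zero⁆-≐)) ⟩
  count (without-v ∘ (inside ∷_)) + count (without-v ∘ (outside ∷_))
    ≡⟨ sym (count-suc without-v) ⟩
  count without-v ∎
  where
  with-v = (zero ∈?_) ∩? P?
  without-v = ∁? (zero ∈?_) ∩? (P? ∘ (_∪ ⁅ zero ⁆))
  ∪⁅zero⁆-≐ : (λ T → zero ∉ outside ∷ T × P (inside ∷ (T ∪ ⊥))) ≐ (λ T → P (inside ∷ T))
  ∪⁅zero⁆-≐ = (λ {T} (_ , p) → subst (λ U → P (inside ∷ U)) (∪-identityʳ T) p)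
            , (λ {T} p → (λ ()) , subst (λ U → P (inside ∷ U)) (sym (∪-identityʳ T)) p)
count-insert {suc n} (suc v) {P} P? = begin
  count with-v
    ≡⟨ count-suc with-v ⟩
  count (with-v ∘ (inside ∷_)) + count (with-v ∘ (outside ∷_))
    ≡⟨ cong₂ _+_ (insert-∷ inside) (insert-∷ outside) ⟩
  count (without-v ∘ (inside ∷_)) + count (without-v ∘ (outside ∷_))
    ≡⟨ sym (count-suc without-v) ⟩
  count without-v ∎
  where
  with-v = (suc v ∈?_) ∩? P?
  without-v = ∁? (suc v ∈?_) ∩? (P? ∘ (_∪ ⁅ suc v ⁆))
  insert-∷ : ∀ s → count (with-v ∘ (s ∷_)) ≡ count (without-v ∘ (s ∷_))
  insert-∷ s = begin
    count (with-v ∘ (s ∷_))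
      ≡⟨ count-cong (with-v ∘ (s ∷_)) ((v ∈?_) ∩? (P? ∘ (s ∷_)))
           ((λ (i , p) → drop-there i , p) , (λ (i , p) → there i , p)) ⟩
    count ((v ∈?_) ∩? (P? ∘ (s ∷_)))
      ≡⟨ count-insert v (P? ∘ (s ∷_)) ⟩
    count (∁? (v ∈?_) ∩? (P? ∘ (s ∷_) ∘ (_∪ ⁅ v ⁆)))
      ≡⟨ count-cong (∁? (v ∈?_) ∩? (P? ∘ (s ∷_) ∘ (_∪ ⁅ v ⁆))) (without-v ∘ (s ∷_))
           ( (λ (∉ , p) → ∉ ∘ drop-there , subst (λ b → P (b ∷ _)) (sym (∨-identityʳ s)) p)
           , (λ (∉ , p) → ∉ ∘ there , subst (λ b → P (b ∷ _)) (∨-identityʳ s) p)) ⟩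
    count (without-v ∘ (s ∷_)) ∎

size≟0 : Decidable {A = Subset n} (λ T → ∣ T ∣ ≡ 0)
size≟0 T = ∣ T ∣ ℕP.≟ 0

count-empty : count (size≟0 {n}) ≡ 1
count-empty {zero}  = refl
count-empty {suc n} = trans (count-suc (size≟0 {suc n}))
  (cong₂ _+_ (count-none (size≟0 {suc n} ∘ (inside ∷_)) λ _ ()) (count-empty {n}))

x∈p─q⇒x∉q : ∀ {x : Fin n} (p q : Subset n) → x ∈ p ─ q → x ∉ q
x∈p─q⇒x∉q {x = zero}  (_ ∷ p) (inside ∷ q) ()
x∈p─q⇒x∉q {x = zero}  (_ ∷ p) (outside ∷ q) _ ()
x∈p─q⇒x∉q {x = suc x} (_ ∷ p) (_ ∷ q) (there x∈p─q) (there x∈q) = x∈p─q⇒x∉q p q x∈p─q x∈q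

p⊆⊤─q∧x∈p⇒x∉q : {p q : Subset n} {x : Fin n} → p ⊆ ⊤ ─ q → x ∈ p → x ∉ q
p⊆⊤─q∧x∈p⇒x∉q {q = q} p⊆ x∈p = x∈p─q⇒x∉q ⊤ q (p⊆ x∈p)

disjoint⇒p⊆⊤─q : {p q : Subset n} → (∀ {x} → x ∈ p → x ∉ q) → p ⊆ ⊤ ─ q
disjoint⇒p⊆⊤─q disjoint x∈p = x∈p∧x∉q⇒x∈p─q ∈⊤ (disjoint x∈p)

∣p∣≡0⇒x∉p : {x : Fin n} {p : Subset n} → ∣ p ∣ ≡ 0 → x ∉ p
∣p∣≡0⇒x∉p {p = outside ∷ p} eq (there x∈p) = ∣p∣≡0⇒x∉p eq x∈p

∣p∣≡1+m⇒nonempty : ∀ {m} (p : Subset n) → ∣ p ∣ ≡ suc m → Nonempty p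
∣p∣≡1+m⇒nonempty (inside ∷ p)  _  = zero , here
∣p∣≡1+m⇒nonempty (outside ∷ p) eq = Product.map suc there (∣p∣≡1+m⇒nonempty p eq)

∣p∪⁅x⁆∣≡1+∣p∣ : (p : Subset n) {x : Fin n} → x ∉ p → ∣ p ∪ ⁅ x ⁆ ∣ ≡ suc ∣ p ∣
∣p∪⁅x⁆∣≡1+∣p∣ (inside ∷ p)  {zero}  x∉p = contradiction here x∉p
∣p∪⁅x⁆∣≡1+∣p∣ (outside ∷ p) {zero}  _   = cong (suc ∘ ∣_∣) (∪-identityʳ p)
∣p∪⁅x⁆∣≡1+∣p∣ (inside ∷ p)  {suc x} x∉p = cong suc (∣p∪⁅x⁆∣≡1+∣p∣ p (x∉p ∘ there))
∣p∪⁅x⁆∣≡1+∣p∣ (outside ∷ p) {suc x} x∉p = ∣p∪⁅x⁆∣≡1+∣p∣ p (x∉p ∘ there)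

x∈p∪⁅y⁆⁻ : (p : Subset n) {x y : Fin n} → x ∈ p ∪ ⁅ y ⁆ → x ∈ p ⊎ x ≡ y
x∈p∪⁅y⁆⁻ p {y = y} = Sum.map₂ (x∈⁅y⁆⇒x≡y y) ∘ x∈p∪q⁻ p ⁅ y ⁆

x∈p∪⁅x⁆ : (p : Subset n) (x : Fin n) → x ∈ p ∪ ⁅ x ⁆
x∈p∪⁅x⁆ p x = q⊆p∪q p ⁅ x ⁆ (x∈⁅x⁆ x)

x∈p∪⁅y⁆∧x≢y⇒x∈p : (p : Subset n) {x y : Fin n} → x ∈ p ∪ ⁅ y ⁆ → x ≢ y → x ∈ p
x∈p∪⁅y⁆∧x≢y⇒x∈p p x∈ x≢y = Sum.[ (λ x∈p → x∈p) , (λ x≡y → contradiction x≡y x≢y) ] (x∈p∪⁅y⁆⁻ p x∈)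

x∈p∧y∉p⇒x≢y : {p : Subset n} {x y : Fin n} → x ∈ p → y ∉ p → x ≢ y
x∈p∧y∉p⇒x≢y x∈p y∉p refl = y∉p x∈p

p⊆⊤-x⇒x∉p : {p : Subset n} {x : Fin n} → p ⊆ ⊤ ─ ⁅ x ⁆ → x ∉ p
p⊆⊤-x⇒x∉p {x = x} p⊆ x∈p = p⊆⊤─q∧x∈p⇒x∉q p⊆ x∈p (x∈⁅x⁆ x)

x∉p⇒p⊆⊤-x : {p : Subset n} {x : Fin n} → x ∉ p → p ⊆ ⊤ ─ ⁅ x ⁆
x∉p⇒p⊆⊤-x x∉p = disjoint⇒p⊆⊤─q λ y∈p → x≢y⇒x∉⁅y⁆ (x∈p∧y∉p⇒x≢y y∈p x∉p)

module _ {n : ℕ} (G : Graph n) (T : Subset n) where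

  Reachable : Fin n → Fin n → Set
  Reachable x y = ∃[ m ] ReachIn G T m x y

  reachIn-refl : ∀ m x → ReachIn G T m x x
  reachIn-refl zero    x = refl
  reachIn-refl (suc m) x = inj₁ (reachIn-refl m x)

  reachIn-mono : ∀ {m m′ x y} → m ≤ m′ → ReachIn G T m x y → ReachIn G T m′ x y
  reachIn-mono {m′ = m′} z≤n refl = reachIn-refl m′ _
  reachIn-mono (s≤s m≤m′) (inj₁ r)                   = inj₁ (reachIn-mono m≤m′ r)
  reachIn-mono (s≤s m≤m′) (inj₂ (z , z∈T , r , zy)) = inj₂ (z , z∈T , reachIn-mono m≤m′ r , zy)

  reachable-refl : ∀ {x} → Reachable x x
  reachable-refl = 0 , refl

  reachable-step : ∀ {x y z} → Reachable x z → z ∈ T → Edge G z y → Reachable x y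
  reachable-step (m , r) z∈T zy = suc m , inj₂ (_ , z∈T , r , zy)

  reachable-trans : ∀ {x y z} → Reachable x y → Reachable y z → Reachable x z
  reachable-trans x⇝y (zero  , refl)                    = x⇝y
  reachable-trans x⇝y (suc m , inj₁ r)                  = reachable-trans x⇝y (m , r)
  reachable-trans x⇝y (suc m , inj₂ (w , w∈T , r , wz)) =
    reachable-step (reachable-trans x⇝y (m , r)) w∈T wz

  module _ (x : Fin n) where

    ball : ℕ → Subset n
    ball m = tabulate (λ y → does (reachIn? G T m x y))

    ∈-ball⁺ : ∀ {m y} → ReachIn G T m x y → y ∈ ball m
    ∈-ball⁺ {m} {y} r =
      lookup⇒[]= y (ball m) (trans (lookup∘tabulate _ y) (dec-true (reachIn? G T m x y) r))

    ∈-ball⁻ : ∀ {m y} → y ∈ ball m → ReachIn G T m x y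
    ∈-ball⁻ {m} {y} y∈ = invert (subst (Reflects _) does≡true (proof (reachIn? G T m x y)))
      where does≡true = trans (sym (lookup∘tabulate _ y)) ([]=⇒lookup y∈)

    Stable : ℕ → Set
    Stable m = ∀ {y} → ReachIn G T (suc m) x y → ReachIn G T m x y

    stable⇒reachIn-+ : ∀ {m} → Stable m → ∀ d {y} → ReachIn G T (d + m) x y → ReachIn G T m x y
    stable⇒reachIn-+ st zero    r                          = r
    stable⇒reachIn-+ st (suc d) (inj₁ r)                   = stable⇒reachIn-+ st d r
    stable⇒reachIn-+ st (suc d) (inj₂ (z , z∈T , r , zy)) =
      st (inj₂ (z , z∈T , stable⇒reachIn-+ st d r , zy))

    -- Pigeonhole: while the balls keep growing, ball m has more than m elements,
    -- which is impossible for m = n.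
    stable⊎ball-grows : ∀ m → (∃[ m′ ] m′ ≤ m × Stable m′) ⊎ m < ∣ ball m ∣
    stable⊎ball-grows zero = inj₂ (ℕP.n≢0⇒n>0 λ eq → ∣p∣≡0⇒x∉p eq (∈-ball⁺ {0} refl))
    stable⊎ball-grows (suc m) with stable⊎ball-grows m
    ... | inj₁ (m′ , m′≤m , st) = inj₁ (m′ , ℕP.m≤n⇒m≤1+n m′≤m , st)
    ... | inj₂ m<∣ball∣ with ball m ⊂? ball (suc m)
    ...   | yes ⊂ = inj₂ (ℕP.≤-trans (s≤s m<∣ball∣) (p⊂q⇒∣p∣<∣q∣ ⊂))
    ...   | no ⊄  = inj₁ (m , ℕP.n≤1+n m , stable)
      where
      stable : Stable m
      stable {y} r with y ∈? ball m
      ... | yes y∈ = ∈-ball⁻ y∈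
      ... | no y∉  =
        contradiction ((λ {z} z∈ → ∈-ball⁺ {suc m} (inj₁ (∈-ball⁻ z∈))) , y , ∈-ball⁺ r , y∉) ⊄

    reachable⇒reachIn : ∀ {y} → Reachable x y → ReachIn G T n x y
    reachable⇒reachIn (m , r) with stable⊎ball-grows n
    ... | inj₂ n<∣ball∣          = contradiction (∣p∣≤n (ball n)) (ℕP.<⇒≱ n<∣ball∣)
    ... | inj₁ (m′ , m′≤n , st) =
      reachIn-mono m′≤n (stable⇒reachIn-+ st m (reachIn-mono (ℕP.m≤m+n m m′) r))

  connected⁺ : (∀ {x y} → x ∈ T → y ∈ T → Reachable x y) → InducesConnected G T
  connected⁺ reach x x∈T y y∈T = reachable⇒reachIn x (reach x∈T y∈T)

module _ {n : ℕ} {G₁ G₂ : Graph n} {T : Subset n}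
         (edge-mono : ∀ {x y} → x ∈ T → Edge G₁ x y → Edge G₂ x y) where

  reachIn-edge-mono : ∀ {m x y} → ReachIn G₁ T m x y → ReachIn G₂ T m x y
  reachIn-edge-mono {zero}  refl                       = refl
  reachIn-edge-mono {suc m} (inj₁ r)                   = inj₁ (reachIn-edge-mono r)
  reachIn-edge-mono {suc m} (inj₂ (z , z∈T , r , zy)) =
    inj₂ (z , z∈T , reachIn-edge-mono r , edge-mono z∈T zy)

  connected-edge-mono : InducesConnected G₁ T → InducesConnected G₂ T
  connected-edge-mono c x x∈T y y∈T = reachIn-edge-mono (c x x∈T y y∈T)

module _ {n : ℕ} (G : Graph n) (v : Fin n) where

  closedNbhd⁻ : ∀ {x} → x ∈ closedNbhd G v → x ≡ v ⊎ Edge G v x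
  closedNbhd⁻ {x} x∈N with x ≟ v | trans (sym (lookup∘tabulate _ x)) ([]=⇒lookup x∈N)
  ... | yes x≡v | _  = inj₁ x≡v
  ... | no _    | vx = inj₂ vx

  closedNbhd⁺ : ∀ {x} → x ≡ v ⊎ Edge G v x → x ∈ closedNbhd G v
  closedNbhd⁺ {x} x≡v⊎vx =
    lookup⇒[]= x (closedNbhd G v) (trans (lookup∘tabulate _ x) (holds x≡v⊎vx))
    where
    holds : x ≡ v ⊎ Edge G v x → (⌊ x ≟ v ⌋ ∨ adj G v x) ≡ true
    holds x≡v⊎vx with x ≟ v | x≡v⊎vx
    ... | yes _   | _        = refl
    ... | no x≢v  | inj₁ x≡v = contradiction x≡v x≢v
    ... | no _    | inj₂ vx  = vx

  contract-edge⁺ : ∀ {x y} → Edge G x y → Edge (contractAdj G v) x y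
  contract-edge⁺ xy rewrite xy = refl

  contract-edge⁺-nbhd : ∀ {x y} → x ≢ y → Edge G v x → Edge G v y → Edge (contractAdj G v) x y
  contract-edge⁺-nbhd {x} {y} x≢y vx vy with x ≟ y
  ... | yes x≡y = contradiction x≡y x≢y
  ... | no _ rewrite vx | vy = ∨-zeroʳ _

  contract-edge⁻ : ∀ {x y} → Edge (contractAdj G v) x y → Edge G x y ⊎ (Edge G v x × Edge G v y)
  contract-edge⁻ {x} {y} = split (adj G x y) (not ⌊ x ≟ y ⌋) (adj G v x) (adj G v y)
    where
    split : ∀ a b c d → a ∨ (b ∧ (c ∧ d)) ≡ true → a ≡ true ⊎ (c ≡ true × d ≡ true)
    split true  _     _     _     _  = inj₁ refl
    split false true  true  true  _  = inj₂ (refl , refl)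
    split false false _     _     ()
    split false true  false _     ()
    split false true  true  false ()

  MeetsNbhd : Subset n → Set
  MeetsNbhd T = ∃[ w ] w ∈ T × Edge G v w

  meetsNbhd? : Decidable MeetsNbhd
  meetsNbhd? T = any? λ w → (w ∈? T) ×-dec (adj G v w Bool.≟ true)

module _ {n : ℕ} {G : Graph n} (simple : IsSimple G) (v : Fin n) where

  private
    G/v : Graph n
    G/v = contractAdj G v

    edge-sym : ∀ {x y} → Edge G x y → Edge G y x
    edge-sym {x} {y} xy = trans (IsSimple.sym simple y x) xy

    no-loop : ∀ {x} → ¬ Edge G x x
    no-loop {x} xx with trans (sym (IsSimple.irrefl simple x)) xx
    ... | ()

  module _ {T : Subset n} (v∉T : v ∉ T) where

    contract-reachIn⇒reachable : ∀ {m x y} → ReachIn G/v T m x y → Reachable G (T ∪ ⁅ v ⁆) x y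
    contract-reachIn⇒reachable {zero}  refl     = reachable-refl G _
    contract-reachIn⇒reachable {suc m} (inj₁ r) = contract-reachIn⇒reachable r
    contract-reachIn⇒reachable {suc m} (inj₂ (z , z∈T , r , zy)) with contract-edge⁻ G v zy
    ... | inj₁ zy′       = reachable-step G _ (contract-reachIn⇒reachable r) (p⊆p∪q ⁅ v ⁆ z∈T) zy′
    ... | inj₂ (vz , vy) =
      reachable-step G _
        (reachable-step G _ (contract-reachIn⇒reachable r) (p⊆p∪q ⁅ v ⁆ z∈T) (edge-sym vz))
        (x∈p∪⁅x⁆ T v) vy

    -- In G / v the vertex v is merged into its neighbours, so it is represented by any
    -- neighbour of v in T, and every other vertex by itself.
    _represents_ : Fin n → Fin n → Set
    w represents y = (y ≢ v × w ≡ y) ⊎ (y ≡ v × w ∈ T × Edge G v w)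

    reachIn⇒contract-reachable : ∀ {m x y} → x ∈ T → ReachIn G (T ∪ ⁅ v ⁆) m x y →
      ∃[ w ] w represents y × Reachable G/v T x w
    reachIn⇒contract-reachable {zero} {x} x∈T refl =
      x , inj₁ (x∈p∧y∉p⇒x≢y x∈T v∉T , refl) , reachable-refl G/v T
    reachIn⇒contract-reachable {suc m} x∈T (inj₁ r) = reachIn⇒contract-reachable x∈T r
    reachIn⇒contract-reachable {suc m} {y = y} x∈T (inj₂ (z , z∈T⁺ , r , zy))
      with reachIn⇒contract-reachable x∈T r | y ≟ v
    ... | _ , inj₁ (z≢v , refl) , x⇝z | yes refl =
      z , inj₂ (refl , x∈p∪⁅y⁆∧x≢y⇒x∈p T z∈T⁺ z≢v , edge-sym zy) , x⇝z
    ... | _ , inj₁ (z≢v , refl) , x⇝z | no y≢v =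
      y , inj₁ (y≢v , refl) ,
      reachable-step G/v T x⇝z (x∈p∪⁅y⁆∧x≢y⇒x∈p T z∈T⁺ z≢v) (contract-edge⁺ G v zy)
    ... | _ , inj₂ (refl , _ , _) , _ | yes refl = contradiction zy no-loop
    ... | w , inj₂ (refl , w∈T , vw) , x⇝w | no y≢v with w ≟ y
    ...   | yes refl = w , inj₁ (y≢v , refl) , x⇝w
    ...   | no w≢y   =
      y , inj₁ (y≢v , refl) , reachable-step G/v T x⇝w w∈T (contract-edge⁺-nbhd G v w≢y vw zy)

    whole⇒contract : ∀ {j} → IsConnectedSetOfSize (whole G) (2 + j) (T ∪ ⁅ v ⁆) →
      MeetsNbhd G v T × IsConnectedSetOfSize (contract G v) (suc j) T
    whole⇒contract {j} (_ , size , conn) = meets , x∉p⇒p⊆⊤-x v∉T , size′ , conn′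
      where
      size′ : ∣ T ∣ ≡ suc j
      size′ = ℕP.suc-injective (trans (sym (∣p∪⁅x⁆∣≡1+∣p∣ T v∉T)) size)

      project : ∀ {x y} → x ∈ T → y ∈ T ∪ ⁅ v ⁆ → ∃[ w ] w represents y × Reachable G/v T x w
      project x∈T y∈T⁺ = reachIn⇒contract-reachable x∈T (conn _ (p⊆p∪q ⁅ v ⁆ x∈T) _ y∈T⁺)

      meets : MeetsNbhd G v T
      meets with ∣p∣≡1+m⇒nonempty T size′
      ... | x , x∈T with project x∈T (x∈p∪⁅x⁆ T v)
      ...   | _ , inj₁ (v≢v , _) , _      = contradiction refl v≢v
      ...   | w , inj₂ (_ , w∈T , vw) , _ = w , w∈T , vw

      conn′ : InducesConnected G/v T
      conn′ = connected⁺ G/v T reach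
        where
        reach : ∀ {x y} → x ∈ T → y ∈ T → Reachable G/v T x y
        reach x∈T y∈T with project x∈T (p⊆p∪q ⁅ v ⁆ y∈T)
        ... | _ , inj₁ (_ , refl) , x⇝y = x⇝y
        ... | _ , inj₂ (refl , _) , _   = contradiction y∈T v∉T

  contract⇒whole : ∀ {j T} → MeetsNbhd G v T → IsConnectedSetOfSize (contract G v) (suc j) T →
    v ∉ T × IsConnectedSetOfSize (whole G) (2 + j) (T ∪ ⁅ v ⁆)
  contract⇒whole {j} {T} (w , w∈T , vw) (T⊆ , size , conn) =
    v∉T , (λ _ → ∈⊤) , trans (∣p∪⁅x⁆∣≡1+∣p∣ T v∉T) (cong suc size) , connected⁺ G (T ∪ ⁅ v ⁆) reach
    where
    v∉T : v ∉ T
    v∉T = p⊆⊤-x⇒x∉p T⊆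

    lift : ∀ {x y} → x ∈ T → y ∈ T → Reachable G (T ∪ ⁅ v ⁆) x y
    lift x∈T y∈T = contract-reachIn⇒reachable v∉T (conn _ x∈T _ y∈T)

    reach : ∀ {x y} → x ∈ T ∪ ⁅ v ⁆ → y ∈ T ∪ ⁅ v ⁆ → Reachable G (T ∪ ⁅ v ⁆) x y
    reach x∈ y∈ with x∈p∪⁅y⁆⁻ T x∈ | x∈p∪⁅y⁆⁻ T y∈
    ... | inj₁ x∈T | inj₁ y∈T = lift x∈T y∈T
    ... | inj₁ x∈T | inj₂ refl = reachable-step G _ (lift x∈T w∈T) (p⊆p∪q ⁅ v ⁆ w∈T) (edge-sym vw)
    ... | inj₂ refl | inj₁ y∈T =
      reachable-trans G _ (reachable-step G _ (reachable-refl G _) (x∈p∪⁅x⁆ T v) vw) (lift w∈T y∈T)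
    ... | inj₂ refl | inj₂ refl = reachable-refl G _

module _ {n : ℕ} (G : Graph n) (v : Fin n) where

  whole∌v⇒deleteV : ∀ {k T} → v ∉ T → IsConnectedSetOfSize (whole G) k T →
    IsConnectedSetOfSize (deleteV G v) k T
  whole∌v⇒deleteV v∉T (_ , size , conn) = x∉p⇒p⊆⊤-x v∉T , size , conn

  deleteV⇒whole∌v : ∀ {k T} → IsConnectedSetOfSize (deleteV G v) k T →
    v ∉ T × IsConnectedSetOfSize (whole G) k T
  deleteV⇒whole∌v (T⊆ , size , conn) = p⊆⊤-x⇒x∉p T⊆ , (λ _ → ∈⊤) , size , conn

  contract∖N⇒deleteN : ∀ {k T} → ¬ MeetsNbhd G v T → IsConnectedSetOfSize (contract G v) k T →
    IsConnectedSetOfSize (deleteN G v) k T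
  contract∖N⇒deleteN {T = T} ¬meets (T⊆ , size , conn) =
    disjoint⇒p⊆⊤─q disjoint , size , connected-edge-mono edge-mono conn
    where
    disjoint : ∀ {x} → x ∈ T → x ∉ closedNbhd G v
    disjoint x∈T x∈N with closedNbhd⁻ G v x∈N
    ... | inj₁ refl = p⊆⊤-x⇒x∉p T⊆ x∈T
    ... | inj₂ vx   = ¬meets (_ , x∈T , vx)

    edge-mono : ∀ {x y} → x ∈ T → Edge (contractAdj G v) x y → Edge G x y
    edge-mono x∈T xy with contract-edge⁻ G v xy
    ... | inj₁ xy′      = xy′
    ... | inj₂ (vx , _) = contradiction (_ , x∈T , vx) ¬meets

  deleteN⇒contract∖N : ∀ {k T} → IsConnectedSetOfSize (deleteN G v) k T →
    ¬ MeetsNbhd G v T × IsConnectedSetOfSize (contract G v) k T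
  deleteN⇒contract∖N {T = T} (T⊆ , size , conn) =
    (λ (_ , w∈T , vw) → ∉N w∈T (closedNbhd⁺ G v (inj₂ vw))) ,
    x∉p⇒p⊆⊤-x (λ v∈T → ∉N v∈T (closedNbhd⁺ G v (inj₁ refl))) ,
    size ,
    connected-edge-mono (λ _ → contract-edge⁺ G v) conn
    where
    ∉N : ∀ {x} → x ∈ T → x ∉ closedNbhd G v
    ∉N = p⊆⊤─q∧x∈p⇒x∉q T⊆

  S∋ : ℕ → ℕ
  S∋ k = count ((v ∈?_) ∩? isConnectedSetOfSize? (whole G) k)

  S∋-insert : ∀ k → S∋ k ≡ count (∁? (v ∈?_) ∩? (isConnectedSetOfSize? (whole G) k ∘ (_∪ ⁅ v ⁆)))
  S∋-insert k = count-insert v (isConnectedSetOfSize? (whole G) k)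

  S-whole : ∀ k → S (whole G) k ≡ S∋ k + S (deleteV G v) k
  S-whole k = trans (count-partition (isConnectedSetOfSize? (whole G) k) (v ∈?_))
                    (cong (_+_ (S∋ k)) (count-cong _ (isConnectedSetOfSize? (deleteV G v) k)
                      ((λ (v∉T , cs) → whole∌v⇒deleteV v∉T cs) , deleteV⇒whole∌v)))

  S∋-one : S∋ 1 ≡ 1
  S∋-one = begin
    S∋ 1
      ≡⟨ S∋-insert 1 ⟩
    count (∁? (v ∈?_) ∩? (isConnectedSetOfSize? (whole G) 1 ∘ (_∪ ⁅ v ⁆)))
      ≡⟨ count-cong _ (size≟0 {n}) (to , from) ⟩
    count (size≟0 {n})
      ≡⟨ count-empty {n} ⟩
    1 ∎
    where
    to : ∀ {T} → v ∉ T × IsConnectedSetOfSize (whole G) 1 (T ∪ ⁅ v ⁆) → ∣ T ∣ ≡ 0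
    to {T} (v∉T , _ , size , _) = ℕP.suc-injective (trans (sym (∣p∪⁅x⁆∣≡1+∣p∣ T v∉T)) size)

    from : ∀ {T} → ∣ T ∣ ≡ 0 → v ∉ T × IsConnectedSetOfSize (whole G) 1 (T ∪ ⁅ v ⁆)
    from {T} ∣T∣≡0 = v∉T , (λ _ → ∈⊤) , trans (∣p∪⁅x⁆∣≡1+∣p∣ T v∉T) (cong suc ∣T∣≡0) , conn
      where
      v∉T = ∣p∣≡0⇒x∉p ∣T∣≡0

      ≡v : ∀ {x} → x ∈ T ∪ ⁅ v ⁆ → x ≡ v
      ≡v x∈ = Sum.[ (λ x∈T → contradiction x∈T (∣p∣≡0⇒x∉p ∣T∣≡0)) , (λ x≡v → x≡v) ] (x∈p∪⁅y⁆⁻ T x∈)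

      conn : InducesConnected G (T ∪ ⁅ v ⁆)
      conn x x∈ y y∈ rewrite ≡v x∈ | ≡v y∈ = reachIn-refl G _ n v

  S-contract : IsSimple G → ∀ j → S (contract G v) (suc j) ≡ S∋ (2 + j) + S (deleteN G v) (suc j)
  S-contract simple j = begin
    count cs/v
      ≡⟨ count-partition cs/v (meetsNbhd? G v) ⟩
    count (meetsNbhd? G v ∩? cs/v) + count (∁? (meetsNbhd? G v) ∩? cs/v)
      ≡⟨ cong₂ _+_
           (count-cong _ inserted
             ((λ (meets , cs) → contract⇒whole simple v meets cs) ,
              (λ (v∉T , cs) → whole⇒contract simple v v∉T cs)))
           (count-cong _ (isConnectedSetOfSize? (deleteN G v) (suc j))
             ((λ (¬meets , cs) → contract∖N⇒deleteN ¬meets cs) , deleteN⇒contract∖N)) ⟩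
    count inserted + S (deleteN G v) (suc j)
      ≡⟨ cong (_+ S (deleteN G v) (suc j)) (sym (S∋-insert (2 + j))) ⟩
    S∋ (2 + j) + S (deleteN G v) (suc j) ∎
    where
    cs/v = isConnectedSetOfSize? (contract G v) (suc j)
    inserted = ∁? (v ∈?_) ∩? (isConnectedSetOfSize? (whole G) (2 + j) ∘ (_∪ ⁅ v ⁆))

+[m+n]-+n≡+m : ∀ m n → + (m + n) -ℤ + n ≡ + m
+[m+n]-+n≡+m m n = begin
  + (m + n) -ℤ + n  ≡⟨ ℤP.[+m]-[+n]≡m⊖n (m + n) n ⟩
  (m + n) ⊖ n       ≡⟨ ℤP.⊖-≥ (ℕP.m≤n+m n m) ⟩
  + (m + n ∸ n)     ≡⟨ cong +_ (ℕP.m+n∸n≡m m n) ⟩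
  + m               ∎

corollary2p4 : (n : ℕ) (G : Graph n) → IsSimple G → (v : Fin n) →
    (k : ℕ) →
    CS (whole G) k ≡
      (CS (deleteV G v) +ₚ X* (CS (contract G v) -ₚ CS (deleteN G v) +ₚ oneₚ)) k
corollary2p4 n G simple v zero          = refl
corollary2p4 n G simple v (suc zero)    = cong +_ (begin
  S (whole G) 1                 ≡⟨ S-whole G v 1 ⟩
  S∋ G v 1 + S (deleteV G v) 1  ≡⟨ cong (_+ S (deleteV G v) 1) (S∋-one G v) ⟩
  1 + S (deleteV G v) 1         ≡⟨ ℕP.+-comm 1 _ ⟩
  S (deleteV G v) 1 + 1         ∎)
corollary2p4 n G simple v (suc (suc j)) = begin
  + S (whole G) (2 + j)
    ≡⟨ cong +_ (trans (S-whole G v (2 + j)) (ℕP.+-comm s∋ s-v)) ⟩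
  + s-v +ℤ + s∋
    ≡⟨ cong (+ s-v +ℤ_) (sym (+[m+n]-+n≡+m s∋ s-N)) ⟩
  + s-v +ℤ (+ (s∋ + s-N) -ℤ + s-N)
    ≡⟨ cong (λ m → + s-v +ℤ (+ m -ℤ + s-N)) (sym (S-contract G v simple j)) ⟩
  + s-v +ℤ (+ s/v -ℤ + s-N)
    ≡⟨ cong (+ s-v +ℤ_) (sym (ℤP.+-identityʳ (+ s/v -ℤ + s-N))) ⟩
  + s-v +ℤ ((+ s/v -ℤ + s-N) +ℤ 0ℤ) ∎
  where
  s∋  = S∋ G v (2 + j)
  s-v = S (deleteV G v) (2 + j)
  s-N = S (deleteN G v) (suc j)
  s/v = S (contract G v) (suc j)
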